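{- Let $a$ be a positive integer that is divisible by $2$ but not divisible by $10$. Then $c_{10}(a^n) \ge \log_4 n$ for all integers $n > 1$.
   Context: For an integer $b \ge 2$ and a nonnegative integer $N$, $c_b(N)$ denotes the number of nonzero digits in the base-$b$ expansion of $N$. -}

module Defs where

open import Data.Nat using (ℕ; zero; suc; _+_; _≤_; NonZero)
open import Data.Nat.DivMod using (_/_; _%_)

-- Number of nonzero base-b digits of n, computed by repeated division by b.
-- The first argument is fuel; fuel ≥ n suffices when b ≥ 2, since each step
-- with n ≥ 1 strictly decreases n.
nonzeroDigitsAux : (b : ℕ) → .{{_ : NonZero b}} → ℕ → ℕ → ℕ
nonzeroDigitsAux b zero    _       = 0
nonzeroDigitsAux b (suc f) zero    = 0
nonzeroDigitsAux b (suc f) (suc n) with suc n % b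
... | zero  = nonzeroDigitsAux b f (suc n / b)
... | suc _ = suc (nonzeroDigitsAux b f (suc n / b))

c : (b : ℕ) → .{{_ : NonZero b}} → ℕ → ℕ
c b N = nonzeroDigitsAux b N N

-- Read the decimal digits of N from the lowest one up. If the part T read so
-- far has k nonzero digits and 2 ^ j ∣ T forces j < 4 ^ k, appending a nonzero
-- digit at position m keeps the invariant with k + 1: a power 2 ^ j with j ≤ m
-- dividing the new number already divides T, and if j > m then 2 ^ m ∣ T gives
-- m < 4 ^ k while 2 ^ j ≤ (new number) < 10 ^ (m + 1) ≤ 16 ^ (m + 1) gives
-- j < 4 (m + 1) ≤ 4 ^ (k + 1). Zero digits change nothing. For N = a ^ n with
-- a even, 2 ^ n ∣ N, and 10 ∤ a forces 10 ∤ a ^ n, so the lowest digit of N is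
-- nonzero and starts the induction.
module Submission where

open import Defs
open import Data.Nat using (ℕ; _≤_; _<_; _^_)
open import Data.Nat.Divisibility using (_∣_)
open import Relation.Nullary using (¬_)

open import Data.Nat using (zero; suc; _+_; _*_; _∸_; z≤n; s≤s; NonZero; >-nonZero; _≤?_)
open import Data.Nat.Properties
open import Data.Nat.Divisibility
  using (divides; ∣-trans; ∣1⇒≡1; ∣m+n∣m⇒∣n; ∣m⇒∣m*n; ∣⇒≤; m*n∣⇒n∣; *-pres-∣; *-monoˡ-∣)
open import Data.Nat.DivMod using (_/_; _%_; m≡m%n+[m/n]*n; m%n<n; m/n<m)
open import Data.Nat.Coprimality using (Coprime; coprime?; coprime-divisor)
open import Data.Nat.Primality using (Prime; prime?; prime⇒nonTrivial; euclidsLemma)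
open import Data.Nat.Base using (nonTrivial⇒≢1)
open import Data.Sum using (inj₁; inj₂)
open import Relation.Nullary using (yes; no; contradiction)
open import Relation.Nullary.Decidable using (from-yes)
open import Relation.Binary.PropositionalEquality

^-pres-∣ : ∀ {d m} n → d ∣ m → d ^ n ∣ m ^ n
^-pres-∣ zero    d∣m = divides 1 refl
^-pres-∣ (suc n) d∣m = *-pres-∣ d∣m (^-pres-∣ n d∣m)

^-monoʳ-∣ : ∀ b {m n} → m ≤ n → b ^ m ∣ b ^ n
^-monoʳ-∣ b {m} {n} m≤n = divides (b ^ (n ∸ m)) (begin
  b ^ n             ≡⟨ cong (b ^_) (m∸n+n≡m m≤n) ⟨
  b ^ (n ∸ m + m)   ≡⟨ ^-distribˡ-+-* b (n ∸ m) m ⟩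
  b ^ (n ∸ m) * b ^ m ∎)
  where open ≡-Reasoning

^-cancelˡ-< : ∀ b .{{_ : NonZero b}} {m n} → b ^ m < b ^ n → m < n
^-cancelˡ-< b {m} {n} bᵐ<bⁿ with n ≤? m
... | yes n≤m = contradiction (^-monoʳ-≤ b n≤m) (<⇒≱ bᵐ<bⁿ)
... | no  n≰m = ≰⇒> n≰m

prime∣^⇒∣ : ∀ {p} m n → Prime p → p ∣ m ^ n → p ∣ m
prime∣^⇒∣ m zero    pp p∣1 = contradiction (∣1⇒≡1 p∣1) (nonTrivial⇒≢1 {{prime⇒nonTrivial pp}})
prime∣^⇒∣ m (suc n) pp p∣mᵐ⁺¹ with euclidsLemma m (m ^ n) pp p∣mᵐ⁺¹
... | inj₁ p∣m  = p∣m
... | inj₂ p∣mⁿ = prime∣^⇒∣ m n pp p∣mⁿ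

coprime∧∣∧∣⇒*∣ : ∀ {m n k} → Coprime m n → m ∣ k → n ∣ k → m * n ∣ k
coprime∧∣∧∣⇒*∣ {m} {n} coprime m∣k (divides q refl) =
  *-monoˡ-∣ n (coprime-divisor coprime (subst (m ∣_) (*-comm q n) m∣k))

even∧10∤⇒10∤^ : ∀ {a} n → 2 ∣ a → ¬ (10 ∣ a) → ¬ (10 ∣ a ^ n)
even∧10∤⇒10∤^ {a} n 2∣a 10∤a 10∣aⁿ = 10∤a (coprime∧∣∧∣⇒*∣ coprime[2,5] 2∣a 5∣a)
  where
  coprime[2,5] : Coprime 2 5
  coprime[2,5] = from-yes (coprime? 2 5)
  5∣a : 5 ∣ a
  5∣a = prime∣^⇒∣ a n (from-yes (prime? 5)) (m*n∣⇒n∣ 2 5 10∣aⁿ)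

infix 4 ν₂_<_
ν₂_<_ : ℕ → ℕ → Set
ν₂ T < b = ∀ j → 2 ^ j ∣ T → j < b

ν₂<⇒>0 : ∀ {T b} → ν₂ T < b → 0 < T
ν₂<⇒>0 {zero}  {b} ν₂0<b = contradiction (ν₂0<b b (divides 0 refl)) (<-irrefl refl)
ν₂<⇒>0 {suc T} _        = s≤s z≤n

ν₂<-bound : ∀ {T} m → 0 < T → T < 10 ^ m → ν₂ T < 4 * m
ν₂<-bound {T} m T>0 T<10ᵐ j 2ʲ∣T = ^-cancelˡ-< 2 (begin-strict
  2 ^ j        ≤⟨ ∣⇒≤ {{>-nonZero T>0}} 2ʲ∣T ⟩
  T            <⟨ T<10ᵐ ⟩
  10 ^ m       ≤⟨ ^-monoˡ-≤ m (from-yes (10 ≤? 16)) ⟩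
  16 ^ m       ≡⟨ ^-*-assoc 2 4 m ⟩
  2 ^ (4 * m)  ∎)
  where open ≤-Reasoning

∣-lowDigits : ∀ {j} T m r → j ≤ m → 2 ^ j ∣ T + 10 ^ m * r → 2 ^ j ∣ T
∣-lowDigits {j} T m r j≤m 2ʲ∣T′ =
  ∣m+n∣m⇒∣n (subst (2 ^ j ∣_) (+-comm T _) 2ʲ∣T′) 2ʲ∣10ᵐr
  where
  2ʲ∣10ᵐr : 2 ^ j ∣ 10 ^ m * r
  2ʲ∣10ᵐr = ∣m⇒∣m*n r (∣-trans (^-monoʳ-∣ 2 j≤m) (^-pres-∣ m (divides 5 refl)))

appendDigit-< : ∀ {T r} m → T < 10 ^ m → r < 10 → T + 10 ^ m * r < 10 ^ suc m
appendDigit-< {T} {r} m T<10ᵐ r<10 = begin-strict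
  T + 10 ^ m * r       <⟨ +-monoˡ-< (10 ^ m * r) T<10ᵐ ⟩
  10 ^ m + 10 ^ m * r  ≡⟨ *-suc (10 ^ m) r ⟨
  10 ^ m * suc r       ≤⟨ *-monoʳ-≤ (10 ^ m) r<10 ⟩
  10 ^ m * 10          ≡⟨ *-comm (10 ^ m) 10 ⟩
  10 ^ suc m           ∎
  where open ≤-Reasoning

ν₂<-appendDigit : ∀ {T m k} r → T < 10 ^ m → r < 10 → ν₂ T < 4 ^ k →
                  ν₂ T + 10 ^ m * r < 4 ^ suc k
ν₂<-appendDigit {T} {m} {k} r T<10ᵐ r<10 ν₂T<4ᵏ j 2ʲ∣T′ with j ≤? m
... | yes j≤m = <-≤-trans (ν₂T<4ᵏ j (∣-lowDigits T m r j≤m 2ʲ∣T′)) (m≤n*m (4 ^ k) 4)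
... | no  j≰m = <-≤-trans j<4[1+m] (*-monoʳ-≤ 4 m<4ᵏ)
  where
  m<4ᵏ : m < 4 ^ k
  m<4ᵏ = ν₂T<4ᵏ m (∣-lowDigits T m r ≤-refl (∣-trans (^-monoʳ-∣ 2 (<⇒≤ (≰⇒> j≰m))) 2ʲ∣T′))
  j<4[1+m] : j < 4 * suc m
  j<4[1+m] = ν₂<-bound (suc m) (≤-trans (ν₂<⇒>0 ν₂T<4ᵏ) (m≤m+n T (10 ^ m * r))) (appendDigit-< m T<10ᵐ r<10) j 2ʲ∣T′

10^-shift : ∀ m q → 10 ^ m * (q * 10) ≡ 10 ^ suc m * q
10^-shift m q = begin
  10 ^ m * (q * 10)  ≡⟨ cong (10 ^ m *_) (*-comm q 10) ⟩
  10 ^ m * (10 * q)  ≡⟨ *-assoc (10 ^ m) 10 q ⟨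
  10 ^ m * 10 * q    ≡⟨ cong (_* q) (*-comm (10 ^ m) 10) ⟩
  10 ^ suc m * q     ∎
  where open ≡-Reasoning

splitLowestDigit : ∀ T m r₀ q → T + 10 ^ m * (r₀ + q * 10) ≡ (T + 10 ^ m * r₀) + 10 ^ suc m * q
splitLowestDigit T m r₀ q = begin
  T + 10 ^ m * (r₀ + q * 10)            ≡⟨ cong (T +_) (*-distribˡ-+ (10 ^ m) r₀ (q * 10)) ⟩
  T + (10 ^ m * r₀ + 10 ^ m * (q * 10)) ≡⟨ +-assoc T _ _ ⟨
  (T + 10 ^ m * r₀) + 10 ^ m * (q * 10) ≡⟨ cong (T + 10 ^ m * r₀ +_) (10^-shift m q) ⟩
  (T + 10 ^ m * r₀) + 10 ^ suc m * q    ∎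
  where open ≡-Reasoning

ν₂<-append0 : ∀ {T} m k → ν₂ T < 4 ^ k → ν₂ T + 10 ^ m * 0 < 4 ^ (k + 0)
ν₂<-append0 {T} m k rewrite *-zeroʳ (10 ^ m) | +-identityʳ T | +-identityʳ k = λ ν₂T<4ᵏ → ν₂T<4ᵏ

[1+r]/10≤r : ∀ r → suc r / 10 ≤ r
[1+r]/10≤r r = ≤-pred (m/n<m (suc r) 10 (s≤s (s≤s z≤n)))

-- f is fuel as in nonzeroDigitsAux; R ≤ f ensures it does not run out.
ν₂<-appendDigits : ∀ f {T m k} R → R ≤ f → T < 10 ^ m → ν₂ T < 4 ^ k →
                   ν₂ T + 10 ^ m * R < 4 ^ (k + nonzeroDigitsAux 10 f R)
ν₂<-appendDigits zero    {m = m} {k} zero _ _ = ν₂<-append0 m k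
ν₂<-appendDigits (suc f) {m = m} {k} zero _ _ = ν₂<-append0 m k
ν₂<-appendDigits (suc f) {T} {m} {k} (suc r) (s≤s r≤f) T<10ᵐ ν₂T<4ᵏ
  with suc r % 10 | m≡m%n+[m/n]*n (suc r) 10 | m%n<n (suc r) 10
... | zero | R≡ | _ =
  subst (λ N → ν₂ N < 4 ^ (k + nonzeroDigitsAux 10 f q)) (sym T+10ᵐR≡)
    (ν₂<-appendDigits f {m = suc m} {k} q q≤f (<-≤-trans T<10ᵐ (m≤n*m (10 ^ m) 10)) ν₂T<4ᵏ)
  where
  q = suc r / 10
  q≤f = ≤-trans ([1+r]/10≤r r) r≤f
  T+10ᵐR≡ : T + 10 ^ m * suc r ≡ T + 10 ^ suc m * q
  T+10ᵐR≡ = trans (cong (λ R → T + 10 ^ m * R) R≡) (cong (T +_) (10^-shift m q))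
... | suc d | R≡ | r₀<10 =
  subst₂ (λ N l → ν₂ N < 4 ^ l) (sym T+10ᵐR≡) (sym (+-suc k (nonzeroDigitsAux 10 f q)))
    (ν₂<-appendDigits f {m = suc m} {suc k} q q≤f
      (appendDigit-< m T<10ᵐ r₀<10) (ν₂<-appendDigit {m = m} {k} (suc d) T<10ᵐ r₀<10 ν₂T<4ᵏ))
  where
  q = suc r / 10
  q≤f = ≤-trans ([1+r]/10≤r r) r≤f
  T+10ᵐR≡ : T + 10 ^ m * suc r ≡ (T + 10 ^ m * suc d) + 10 ^ suc m * q
  T+10ᵐR≡ = trans (cong (λ R → T + 10 ^ m * R) R≡) (splitLowestDigit T m (suc d) q)

ν₂<4^c : ∀ {N} → 0 < N → ¬ (10 ∣ N) → ν₂ N < 4 ^ c 10 N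
ν₂<4^c {suc r} _ 10∤N with suc r % 10 | m≡m%n+[m/n]*n (suc r) 10 | m%n<n (suc r) 10
... | zero  | N≡ | _     = contradiction (divides (suc r / 10) N≡) 10∤N
... | suc d | N≡ | r₀<10 =
  subst (λ N → ν₂ N < 4 ^ suc (nonzeroDigitsAux 10 r q)) (sym N≡r₀+10q)
    (ν₂<-appendDigits r {m = 1} {1} q ([1+r]/10≤r r) r₀<10 (ν₂<-bound 1 (s≤s z≤n) r₀<10))
  where
  q = suc r / 10
  N≡r₀+10q : suc r ≡ suc d + 10 ^ 1 * q
  N≡r₀+10q = trans N≡ (cong (suc d +_) (trans (sym (*-identityˡ (q * 10))) (10^-shift 0 q)))

corollary3p2 : (a : ℕ) → 0 < a → 2 ∣ a → ¬ (10 ∣ a) →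
    (n : ℕ) → 1 < n → n ≤ 4 ^ c 10 (a ^ n)
corollary3p2 a a>0 2∣a 10∤a n _ =
  <⇒≤ (ν₂<4^c (m^n>0 a n) (even∧10∤⇒10∤^ n 2∣a 10∤a) n (^-pres-∣ n 2∣a))
  where instance _ = >-nonZero a>0
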